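{- Let $\mathcal{H}$ be a fixed finite set of connected graphs containing $K_{1,s}$ for some $s>1$, and let $s$ be the least such integer. Let $t>2$, let $G$ be a $K_t$-free graph, let $M$ be a minimum $\mathcal{H}$ deletion set of $G$, let $d=R(s,t-1)-1$, and let $M_0=\{e\in M: e$ is incident to a vertex of degree at least $d+1$ in $G\}$. Then $G\setminus M_0$ has maximum degree at most $d$, and every vertex of $G$ with degree at least $d+1$ is incident to at least one edge of $M_0$.
   Context: All graphs are finite and simple. $R(s,t)$ is the Ramsey number. A graph is $\mathcal{H}$-free if it has no induced subgraph isomorphic to a member of $\mathcal{H}$. $G\setminus E'=(V(G),E(G)\setminus E')$. An $\mathcal{H}$ deletion set of $G$ is $M\subseteq E(G)$ with $G\setminus M$ $\mathcal{H}$-free; a minimum one has minimum cardinality. -}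

module Defs where

open import Data.Nat using (ℕ; zero; suc; _+_; _≤_; _<_; _<ᵇ_)
open import Data.Bool using (Bool; true; false; _∧_; _∨_; not)
open import Data.Fin as F using (Fin)
open import Data.Fin.Properties using (_≟_)
open import Data.List using (List; []; _∷_; allFin)
open import Data.List.Membership.Propositional using (_∈_)
open import Data.Product using (Σ; _×_; _,_)
open import Data.Sum using (_⊎_)
open import Relation.Nullary using (¬_; yes; no)
open import Relation.Binary.PropositionalEquality using (_≡_; _≢_; refl; sym; cong₂)
open import Function.Definitions using (Injective; Bijective)

record Graph (n : ℕ) : Set where
  field
    adj     : Fin n → Fin n → Bool
    adj-sym : ∀ i j → adj i j ≡ adj j i
    adj-irr : ∀ i → adj i i ≡ false
open Graph public

countB : {A : Set} → (A → Bool) → List A → ℕ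
countB p [] = 0
countB p (x ∷ xs) with p x
... | true  = suc (countB p xs)
... | false = countB p xs

sumL : {A : Set} → (A → ℕ) → List A → ℕ
sumL f [] = 0
sumL f (x ∷ xs) = f x + sumL f xs

deg : ∀ {n} → Graph n → Fin n → ℕ
deg {n} G v = countB (adj G v) (allFin n)

numEdges : ∀ {n} → Graph n → ℕ
numEdges {n} G =
  sumL (λ i → countB (λ j → (F.toℕ i <ᵇ F.toℕ j) ∧ adj G i j) (allFin n)) (allFin n)

-- Edge sets.  A set of edges M ⊆ E(G) is represented as a graph on the
-- same vertex set whose edges are exactly the elements of M.

_⊆E_ : ∀ {n} → Graph n → Graph n → Set
M ⊆E G = ∀ i j → adj M i j ≡ true → adj G i j ≡ true

_∖_ : ∀ {n} → Graph n → Graph n → Graph n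
adj     (G ∖ M) i j = adj G i j ∧ not (adj M i j)
adj-sym (G ∖ M) i j = cong₂ (λ a b → a ∧ not b) (adj-sym G i j) (adj-sym M i j)
adj-irr (G ∖ M) i rewrite adj-irr G i = refl

card : ∀ {n} → Graph n → ℕ
card = numEdges

InducedSub : ∀ {k n} → Graph k → Graph n → Set
InducedSub {k} {n} H G =
  Σ (Fin k → Fin n) λ f → Injective _≡_ _≡_ f × (∀ i j → adj H i j ≡ adj G (f i) (f j))

Iso : ∀ {k n} → Graph k → Graph n → Set
Iso {k} {n} H G =
  Σ (Fin k → Fin n) λ f → Bijective _≡_ _≡_ f × (∀ i j → adj H i j ≡ adj G (f i) (f j))

AGraph : Set
AGraph = Σ ℕ Graph

Family : Set
Family = List AGraph

Free : ∀ {n} → Family → Graph n → Set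
Free 𝓗 G = ∀ {H} → H ∈ 𝓗 → ¬ InducedSub (Σ.proj₂ H) G
  where open import Data.Product as Σ using ()

data Reach {n} (G : Graph n) : Fin n → Fin n → Set where
  here : ∀ {i} → Reach G i i
  step : ∀ {i k j} → adj G i k ≡ true → Reach G k j → Reach G i j

Connected : ∀ {n} → Graph n → Set
Connected {n} G = (0 < n) × (∀ i j → Reach G i j)

K : (t : ℕ) → Graph t
adj     (K t) i j with i ≟ j
... | yes _ = false
... | no  _ = true
adj-sym (K t) i j with i ≟ j | j ≟ i
... | yes _ | yes _ = refl
... | no  _ | no  _ = refl
... | yes p | no ¬q = Data.Empty.⊥-elim (¬q (sym p)) where import Data.Empty
... | no ¬p | yes q = Data.Empty.⊥-elim (¬p (sym q)) where import Data.Empty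
adj-irr (K t) i with i ≟ i
... | yes _ = refl
... | no ¬p = Data.Empty.⊥-elim (¬p refl) where import Data.Empty

Star : (s : ℕ) → Graph (suc s)
adj     (Star s) F.zero    F.zero    = false
adj     (Star s) F.zero    (F.suc _) = true
adj     (Star s) (F.suc _) F.zero    = true
adj     (Star s) (F.suc _) (F.suc _) = false
adj-sym (Star s) F.zero    F.zero    = refl
adj-sym (Star s) F.zero    (F.suc _) = refl
adj-sym (Star s) (F.suc _) F.zero    = refl
adj-sym (Star s) (F.suc _) (F.suc _) = refl
adj-irr (Star s) F.zero    = refl
adj-irr (Star s) (F.suc _) = refl

ContainsStar : Family → ℕ → Set
ContainsStar 𝓗 s = Σ AGraph λ H → H ∈ 𝓗 × Iso (Σ.proj₂ H) (Star s)
  where open import Data.Product as Σ using ()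

HasClique : ∀ {n} → ℕ → Graph n → Set
HasClique {n} a G =
  Σ (Fin a → Fin n) λ f → Injective _≡_ _≡_ f × (∀ i j → i ≢ j → adj G (f i) (f j) ≡ true)

HasIndep : ∀ {n} → ℕ → Graph n → Set
HasIndep {n} a G =
  Σ (Fin a → Fin n) λ f → Injective _≡_ _≡_ f × (∀ i j → adj G (f i) (f j) ≡ false)

RamseyProp : ℕ → ℕ → ℕ → Set
RamseyProp a b N = (G : Graph N) → HasClique a G ⊎ HasIndep b G

IsRamsey : ℕ → ℕ → ℕ → Set
IsRamsey a b r = RamseyProp a b r × (∀ N → N < r → ¬ RamseyProp a b N)

IsDeletionSet : ∀ {n} → Family → Graph n → Graph n → Set
IsDeletionSet 𝓗 G M = M ⊆E G × Free 𝓗 (G ∖ M)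

IsMinDeletionSet : ∀ {n} → Family → Graph n → Graph n → Set
IsMinDeletionSet {n} 𝓗 G M =
  IsDeletionSet 𝓗 G M × (∀ (M' : Graph n) → IsDeletionSet 𝓗 G M' → card M ≤ card M')

highDeg : ∀ {n} → Graph n → ℕ → Fin n → Bool
highDeg G d v = d <ᵇ deg G v

M₀ : ∀ {n} → Graph n → Graph n → ℕ → Graph n
adj     (M₀ G M d) i j = adj M i j ∧ (highDeg G d i ∨ highDeg G d j)
adj-sym (M₀ G M d) i j =
  cong₂ _∧_ (adj-sym M i j) (Data.Bool.Properties.∨-comm (highDeg G d i) (highDeg G d j))
  where import Data.Bool.Properties
adj-irr (M₀ G M d) i rewrite adj-irr M i = refl

-- A vertex v of degree at least R(s,t-1) in a K_t-free graph has, among any R(s,t-1) of its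
-- neighbours, no (t-1)-clique (it would extend by v to a K_t), hence s pairwise non-adjacent
-- ones: an induced K_{1,s} centred at v.  Since G ∖ M is K_{1,s}-free, every degree of G ∖ M
-- is at most d, and every high-degree vertex v has an M-edge to one of the leaves of such a
-- star in G, which lies in M₀.  Finally M₀ contains every M-edge at a high-degree vertex, so
-- around such a vertex G ∖ M₀ coincides with G ∖ M.
module Submission where

open import Defs
open import Data.Nat using (ℕ; zero; suc; _<_; _≤_; _∸_; z≤n; s≤s; _<?_)
open import Data.Nat.Properties using (_≤?_; ≤-trans; ≮⇒≥; ≰⇒>; <⇒<ᵇ; m≤n⇒m≤1+n)
open import Data.Bool using (Bool; true; false; not; _∧_) renaming (_≟_ to _≟ᵇ_)
open import Data.Bool.Properties using (∧-conicalˡ; ∧-identityʳ; ¬-not; not-injective; T-≡)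
open import Data.Fin using (Fin; zero; suc)
open import Data.Fin.Properties using (_≟_; suc-injective; 0≢1+n; any?)
open import Data.Vec.Functional using () renaming (_∷_ to _∷ᶠ_)
open import Data.List using ([]; _∷_; tabulate; allFin)
open import Data.List.Membership.Propositional using (_∈_)
open import Data.Product using (Σ; ∃; _×_; _,_; proj₂)
open import Data.Sum using (_⊎_; inj₁; inj₂)
open import Function using (_∘_; id; Equivalence)
open import Function.Definitions using (Injective)
open import Relation.Nullary using (¬_; yes; no; contradiction)
open import Relation.Binary.PropositionalEquality
  using (_≡_; _≢_; refl; sym; trans; cong)

private
  variable
    n k s : ℕ

countB-mono : ∀ {A : Set} (p q : A → Bool) → (∀ x → p x ≡ true → q x ≡ true) →
              ∀ xs → countB p xs ≤ countB q xs
countB-mono p q p⇒q [] = z≤n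
countB-mono p q p⇒q (x ∷ xs) with p x in px | q x in qx
... | true  | true  = s≤s (countB-mono p q p⇒q xs)
... | true  | false = contradiction (trans (sym (p⇒q x px)) qx) λ ()
... | false | true  = m≤n⇒m≤1+n (countB-mono p q p⇒q xs)
... | false | false = countB-mono p q p⇒q xs

∷-injective : ∀ {A : Set} {x : A} {f : Fin k → A} →
              Injective _≡_ _≡_ f → (∀ i → f i ≢ x) → Injective _≡_ _≡_ (x ∷ᶠ f)
∷-injective f-inj f≢x {zero}  {zero}  _  = refl
∷-injective f-inj f≢x {zero}  {suc j} eq = contradiction (sym eq) (f≢x j)
∷-injective f-inj f≢x {suc i} {zero}  eq = contradiction eq (f≢x i)
∷-injective f-inj f≢x {suc i} {suc j} eq = cong suc (f-inj eq)

countB-tabulate-witnesses : ∀ {A : Set} n (q : A → Bool) (f : Fin n → A) k →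
  k ≤ countB q (tabulate f) →
  Σ (Fin k → Fin n) λ e → Injective _≡_ _≡_ e × (∀ i → q (f (e i)) ≡ true)
countB-tabulate-witnesses n q f zero _ = (λ ()) , (λ { {()} }) , (λ ())
countB-tabulate-witnesses (suc n) q f (suc k) k≤count with q (f zero) in q₀
... | false with countB-tabulate-witnesses n q (f ∘ suc) (suc k) k≤count
...   | e , e-inj , qe = suc ∘ e , e-inj ∘ suc-injective , qe
countB-tabulate-witnesses (suc n) q f (suc k) (s≤s k≤count) | true
  with countB-tabulate-witnesses n q (f ∘ suc) k k≤count
... | e , e-inj , qe =
  zero ∷ᶠ (suc ∘ e) , ∷-injective (e-inj ∘ suc-injective) (λ i → 0≢1+n ∘ sym) ,
  λ { zero → q₀ ; (suc i) → qe i }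

adj⇒≢ : (X : Graph n) {u v : Fin n} → adj X u v ≡ true → u ≢ v
adj⇒≢ X {u} uv refl = contradiction (trans (sym uv) (adj-irr X u)) λ ()

deg-mono : (H G : Graph n) (v : Fin n) → (∀ u → adj H v u ≡ true → adj G v u ≡ true) →
           deg H v ≤ deg G v
deg-mono {n} H G v H⇒G = countB-mono (adj H v) (adj G v) H⇒G (allFin n)

neighbours : (X : Graph n) (v : Fin n) → k ≤ deg X v →
  Σ (Fin k → Fin n) λ e → Injective _≡_ _≡_ e × (∀ i → adj X v (e i) ≡ true)
neighbours {n} {k} X v = countB-tabulate-witnesses n (adj X v) id k

∖-⊆E : (G M : Graph n) → (G ∖ M) ⊆E G
∖-⊆E G M i j = ∧-conicalˡ (adj G i j) _

∖-adj : (G M : Graph n) {i j : Fin n} → adj G i j ≡ true → adj M i j ≡ false →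
        adj (G ∖ M) i j ≡ true
∖-adj G M Gij Mij rewrite Gij | Mij = refl

∖-nonadj : (G M : Graph n) {i j : Fin n} → adj G i j ≡ false → adj (G ∖ M) i j ≡ false
∖-nonadj G M Gij rewrite Gij = refl

K-adj : {i j : Fin n} → i ≢ j → adj (K n) i j ≡ true
K-adj {i = i} {j} i≢j with i ≟ j
... | yes i≡j = contradiction i≡j i≢j
... | no  _   = refl

complement : Graph n → Graph n
complement {n} G = K n ∖ G

induced : (Fin k → Fin n) → Graph n → Graph k
adj     (induced e X) a b = adj X (e a) (e b)
adj-sym (induced e X) a b = adj-sym X (e a) (e b)
adj-irr (induced e X) a   = adj-irr X (e a)

complement-adj : (G : Graph n) {i j : Fin n} → i ≢ j → adj (complement G) i j ≡ not (adj G i j)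
complement-adj G i≢j rewrite K-adj i≢j = refl

clique-complement⇒indep : (G : Graph n) → HasClique k (complement G) → HasIndep k G
clique-complement⇒indep G (f , f-inj , clique) = f , f-inj , nonadj
  where
  nonadj : ∀ i j → adj G (f i) (f j) ≡ false
  nonadj i j with i ≟ j
  ... | yes refl = adj-irr G (f i)
  ... | no  i≢j  = not-injective (trans (sym (complement-adj G (i≢j ∘ f-inj))) (clique i j i≢j))

indep-complement⇒clique : (G : Graph n) → HasIndep k (complement G) → HasClique k G
indep-complement⇒clique G (f , f-inj , indep) = f , f-inj , λ i j i≢j →
  not-injective (trans (sym (complement-adj G (i≢j ∘ f-inj))) (indep i j))

clique-mono : (H G : Graph n) → H ⊆E G → HasClique k H → HasClique k G
clique-mono H G H⊆G (f , f-inj , clique) = f , f-inj , λ i j i≢j → H⊆G _ _ (clique i j i≢j)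

K-free⇒clique-free : (G : Graph n) → ¬ InducedSub (K k) G → ¬ HasClique k G
K-free⇒clique-free G K-free (f , f-inj , clique) = K-free (f , f-inj , preserves)
  where
  preserves : ∀ i j → adj (K _) i j ≡ adj G (f i) (f j)
  preserves i j with i ≟ j
  ... | yes refl = sym (adj-irr G (f i))
  ... | no  i≢j  = sym (clique i j i≢j)

cone-injective : (X : Graph n) {v : Fin n} {f : Fin k → Fin n} →
                 Injective _≡_ _≡_ f → (∀ i → adj X v (f i) ≡ true) → Injective _≡_ _≡_ (v ∷ᶠ f)
cone-injective X f-inj adj-v = ∷-injective f-inj λ i → adj⇒≢ X (adj-v i) ∘ sym

cone-clique : ∀ {r} (X : Graph n) {v : Fin n} {e : Fin r → Fin n} →
              Injective _≡_ _≡_ e → (∀ i → adj X v (e i) ≡ true) →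
              HasClique k (induced e X) → HasClique (suc k) X
cone-clique X {v} {e} e-inj adj-v (f , f-inj , clique) =
  v ∷ᶠ (e ∘ f) , cone-injective X (f-inj ∘ e-inj) (adj-v ∘ f) , adjacent
  where
  adjacent : ∀ i j → i ≢ j → adj X ((v ∷ᶠ (e ∘ f)) i) ((v ∷ᶠ (e ∘ f)) j) ≡ true
  adjacent zero    zero    i≢j = contradiction refl i≢j
  adjacent zero    (suc j) _   = adj-v (f j)
  adjacent (suc i) zero    _   = trans (adj-sym X (e (f i)) v) (adj-v (f i))
  adjacent (suc i) (suc j) i≢j = clique i j (i≢j ∘ cong suc)

StarAt : Graph n → Fin n → ℕ → Set
StarAt {n} X v s = Σ (Fin s → Fin n) λ f → Injective _≡_ _≡_ f ×
  (∀ i → adj X v (f i) ≡ true) × (∀ i j → adj X (f i) (f j) ≡ false)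

StarAt⇒induced-Star : (X : Graph n) (v : Fin n) → StarAt X v s → InducedSub (Star s) X
StarAt⇒induced-Star X v (f , f-inj , adj-v , indep) =
  v ∷ᶠ f , cone-injective X f-inj adj-v , preserves
  where
  preserves : ∀ i j → adj (Star _) i j ≡ adj X ((v ∷ᶠ f) i) ((v ∷ᶠ f) j)
  preserves zero    zero    = sym (adj-irr X v)
  preserves zero    (suc j) = sym (adj-v j)
  preserves (suc i) zero    = sym (trans (adj-sym X (f i) v) (adj-v i))
  preserves (suc i) (suc j) = sym (indep i j)

iso-induced : ∀ {m k} (H : Graph m) (S : Graph k) (X : Graph n) →
              Iso H S → InducedSub S X → InducedSub H X
iso-induced H S X (φ , (φ-inj , _) , φ-pres) (g , g-inj , g-pres) =
  g ∘ φ , φ-inj ∘ g-inj , λ i j → trans (φ-pres i j) (g-pres (φ i) (φ j))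

free⇒¬StarAt : ∀ {𝓗} → ContainsStar 𝓗 s → (X : Graph n) → Free 𝓗 X → ∀ v → ¬ StarAt X v s
free⇒¬StarAt (H , H∈𝓗 , H≅Star) X free v star =
  free H∈𝓗 (iso-induced (proj₂ H) (Star _) X H≅Star (StarAt⇒induced-Star X v star))

ramsey-StarAt : ∀ {r t} (X : Graph n) (v : Fin n) → RamseyProp s t r →
                ¬ HasClique (suc t) X → r ≤ deg X v → StarAt X v s
ramsey-StarAt X v ramsey clique-free r≤deg with neighbours X v r≤deg
... | e , e-inj , adj-v with ramsey (complement (induced e X))
...   | inj₂ indep =
  contradiction (cone-clique X e-inj adj-v (indep-complement⇒clique (induced e X) indep)) clique-free
...   | inj₁ clique with clique-complement⇒indep (induced e X) clique
...     | f , f-inj , indep = e ∘ f , f-inj ∘ e-inj , adj-v ∘ f , indep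

StarAt-∖ : (G M : Graph n) {v : Fin n} → StarAt G v s →
           StarAt (G ∖ M) v s ⊎ ∃ λ u → adj M v u ≡ true
StarAt-∖ G M {v} (f , f-inj , adj-v , indep) with any? (λ i → adj M v (f i) ≟ᵇ true)
... | yes (i , Mvfi) = inj₂ (f i , Mvfi)
... | no  ¬M = inj₁ (f , f-inj , adj-v′ , λ i j → ∖-nonadj G M (indep i j))
  where
  adj-v′ : ∀ i → adj (G ∖ M) v (f i) ≡ true
  adj-v′ i = ∖-adj G M (adj-v i) (¬-not λ Mvfi → ¬M (i , Mvfi))

≤∸1⊎≥ : ∀ r m → m ≤ r ∸ 1 ⊎ r ≤ m
≤∸1⊎≥ zero    m = inj₂ z≤n
≤∸1⊎≥ (suc r) m with m ≤? r
... | yes m≤r = inj₁ m≤r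
... | no  m≰r = inj₂ (≰⇒> m≰r)

∸1<⇒≤ : ∀ r {m} → r ∸ 1 < m → r ≤ m
∸1<⇒≤ zero    _ = z≤n
∸1<⇒≤ (suc r) r<m = r<m

StarAt-free⇒deg≤ : ∀ {r t} (X : Graph n) (v : Fin n) → RamseyProp s t r →
                   ¬ HasClique (suc t) X → ¬ StarAt X v s → deg X v ≤ r ∸ 1
StarAt-free⇒deg≤ {r = r} X v ramsey clique-free no-star with ≤∸1⊎≥ r (deg X v)
... | inj₁ deg≤ = deg≤
... | inj₂ r≤deg = contradiction (ramsey-StarAt X v ramsey clique-free r≤deg) no-star

M₀-high : (G M : Graph n) (d : ℕ) {v u : Fin n} → d < deg G v →
          adj (M₀ G M d) v u ≡ adj M v u
M₀-high G M d {v} {u} d<deg rewrite Equivalence.to T-≡ (<⇒<ᵇ d<deg) = ∧-identityʳ (adj M v u)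

∖M₀-high : (G M : Graph n) (d : ℕ) {v u : Fin n} → d < deg G v →
           adj (G ∖ M₀ G M d) v u ≡ adj (G ∖ M) v u
∖M₀-high G M d {v} {u} d<deg = cong (λ b → adj G v u ∧ not b) (M₀-high G M d d<deg)

lemma9 : (𝓗 : Family)
    → (∀ {H} → H ∈ 𝓗 → Connected (proj₂ H))
    → (s : ℕ) → 1 < s → ContainsStar 𝓗 s
    → (∀ s′ → 1 < s′ → s′ < s → ¬ ContainsStar 𝓗 s′)
    → (t : ℕ) → 2 < t
    → {n : ℕ} (G : Graph n) → ¬ InducedSub (K t) G
    → (M : Graph n) → IsMinDeletionSet 𝓗 G M
    → (r : ℕ) → IsRamsey s (t ∸ 1) r
    → (∀ v → deg (G ∖ M₀ G M (r ∸ 1)) v ≤ r ∸ 1)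
      × (∀ v → r ∸ 1 < deg G v → Σ (Fin n) λ u → adj (M₀ G M (r ∸ 1)) v u ≡ true)
lemma9 𝓗 _ s _ star _ (suc t) _ G K-free M ((_ , free) , _) r (ramsey , _) =
  bounded , hit
  where
  d = r ∸ 1
  clique-free : ¬ HasClique (suc t) G
  clique-free = K-free⇒clique-free G K-free

  G∖M-bounded : ∀ v → deg (G ∖ M) v ≤ d
  G∖M-bounded v = StarAt-free⇒deg≤ (G ∖ M) v ramsey
    (clique-free ∘ clique-mono (G ∖ M) G (∖-⊆E G M)) (free⇒¬StarAt star (G ∖ M) free v)

  bounded : ∀ v → deg (G ∖ M₀ G M d) v ≤ d
  bounded v with d <? deg G v
  ... | yes high = ≤-trans
    (deg-mono (G ∖ M₀ G M d) (G ∖ M) v λ u → trans (sym (∖M₀-high G M d high))) (G∖M-bounded v)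
  ... | no  low  = ≤-trans (deg-mono (G ∖ M₀ G M d) G v (∖-⊆E G (M₀ G M d) v)) (≮⇒≥ low)

  hit : ∀ v → d < deg G v → ∃ λ u → adj (M₀ G M d) v u ≡ true
  hit v high with StarAt-∖ G M (ramsey-StarAt G v ramsey clique-free (∸1<⇒≤ r high))
  ... | inj₁ star-G∖M = contradiction star-G∖M (free⇒¬StarAt star (G ∖ M) free v)
  ... | inj₂ (u , Mvu) = u , trans (M₀-high G M d high) Mvu
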